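{- Let $G$ be a complete $r$-partite graph on $n$ vertices, and for an integer $1\le s\le n$ let $f_G(s):=\max_{P\colon |P|=s}|E(P,G)|$, the maximum over all partitions $P$ of $V(G)$ into exactly $s$ parts. Then $f_G$ is concave upward (convex) in $s$: $f_G(s)+f_G(s+2)\geq 2f_G(s+1)$ for all $2\leq s\leq n-2$.
   Context: A partition of $V(G)$ is a partition into nonempty parts; $|P|$ is its number of parts. $E(P,G)$ is the set of edges of $G$ whose two end vertices lie in the same part of $P$. -}

module Defs where

open import Data.Nat using (ℕ; _+_; _≤_; _<_; _≟_)
open import Data.Fin using (Fin; toℕ)
open import Data.Fin.Properties using () renaming (_≟_ to _≟ᶠ_)
open import Data.List using (List; map; allFin)
open import Data.Nat.ListAction using (sum)
open import Data.Product using (Σ; ∃; _×_)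
open import Data.Bool using (if_then_else_)
open import Relation.Nullary using (¬_; does; _×-dec_; ¬?)
open import Relation.Binary.PropositionalEquality using (_≡_)
open import Data.Nat.Properties using (_<?_)

IsSurjective : ∀ {n k} → (Fin n → Fin k) → Set
IsSurjective {n} {k} f = (j : Fin k) → ∃ λ i → f i ≡ j

-- Complete r-partite graph on vertex set Fin n, given by the assignment
-- c : Fin n → Fin r of vertices to the r (nonempty) parts; u,v adjacent
-- iff c u ≢ c v.
IsCompleteMultipartiteColouring : ∀ {n r} → (Fin n → Fin r) → Set
IsCompleteMultipartiteColouring c = IsSurjective c

IsPartition : ∀ {n s} → (Fin n → Fin s) → Set
IsPartition p = IsSurjective p

inPartEdges : ∀ {n r s} → (Fin n → Fin r) → (Fin n → Fin s) → ℕ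
inPartEdges {n} c p =
  sum (map (λ u → sum (map (λ v →
      if does ((toℕ u <? toℕ v) ×-dec (¬? (c u ≟ᶠ c v) ×-dec (p u ≟ᶠ p v)))
      then 1 else 0) (allFin n))) (allFin n))

IsMaxInPartEdges : ∀ {n r} → (Fin n → Fin r) → (s : ℕ) → ℕ → Set
IsMaxInPartEdges {n} c s m =
  (Σ (Fin n → Fin s) λ p → IsPartition p × inPartEdges c p ≡ m)
  × ((p : Fin n → Fin s) → IsPartition p → inPartEdges c p ≤ m)

-- Take a partition P with s+1 parts and |E(P,G)| = f_G(s+1); as s+1 < n, some part J has
-- two vertices.  Merging another part I into J gives s parts and gains at least the number
-- of G-neighbours in J of any x ∈ I; moving a single v ∈ J into a new part gives s+2 parts
-- and loses exactly the G-neighbours of v in J.  Choosing v of the colour of x if J has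
-- one, and arbitrary otherwise (then every vertex of J is a neighbour of x), the loss is at
-- most the gain, so 2 f_G(s+1) ≤ f_G(s) + f_G(s+2).
module Submission where

open import Defs
open import Data.Nat using (ℕ; zero; suc; _+_; _*_; _≤_; _<_; z≤n; s≤s)
open import Data.Nat.Properties
  using ( ≤-refl; ≤-trans; ≤-antisym; <-irrefl; <-asym; <-cmp; +-mono-≤; +-monoʳ-≤
        ; +-cancelʳ-≤; +-assoc; +-comm; +-identityʳ; m≤m+n; m≤n+m; +-0-commutativeMonoid
        ; _<?_; module ≤-Reasoning)
open import Algebra.Properties.CommutativeMonoid.Sum +-0-commutativeMonoid
  using (sum; sum-syntax; ∑-distrib-+; sum-cong-≗; sum-replicate-zero)
open import Data.Nat.Tactic.RingSolver using (solve-∀)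
open import Data.Nat.ListAction using () renaming (sum to listSum)
open import Data.Fin using (Fin; zero; suc; toℕ; punchIn; punchOut)
open import Data.Fin.Properties
  using (suc-injective; toℕ-injective; punchInᵢ≢i; punchOut-cong; punchOut-punchIn; any?; pigeonhole)
  renaming (_≟_ to _≟ᶠ_)
open import Data.List using (map; allFin; tabulate)
open import Data.List.Properties using (map-tabulate)
open import Data.Bool using (if_then_else_)
open import Data.Product using (∃; ∃₂; _×_; _,_; proj₁; proj₂)
open import Data.Sum using (_⊎_; inj₁; inj₂)
open import Level using (0ℓ)
open import Function using (_∘_; id)
open import Relation.Binary.Core using (Rel; _⇒_)
open import Relation.Binary.Definitions using (Decidable; tri<; tri≈; tri>)
open import Relation.Binary.Construct.Union using (_∪_)
open import Relation.Nullary using (¬_; Dec; yes; no; does; _×-dec_; _⊎-dec_; ¬?; contradiction)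
open import Relation.Unary using (Pred) renaming (Decidable to Decidable₁)
open import Relation.Binary.PropositionalEquality
  using (_≡_; _≢_; refl; sym; trans; cong; cong₂; subst; module ≡-Reasoning)

private variable
  P Q R : Set

𝟙 : Dec P → ℕ
𝟙 P? = if does P? then 1 else 0

𝟙-mono : (P? : Dec P) (Q? : Dec Q) → (P → Q) → 𝟙 P? ≤ 𝟙 Q?
𝟙-mono (yes p) (yes _) _ = ≤-refl
𝟙-mono (yes p) (no ¬q) f = contradiction (f p) ¬q
𝟙-mono (no _) _ _ = z≤n

𝟙-cong : (P? : Dec P) (Q? : Dec Q) → (P → Q) → (Q → P) → 𝟙 P? ≡ 𝟙 Q?
𝟙-cong P? Q? f g = ≤-antisym (𝟙-mono P? Q? f) (𝟙-mono Q? P? g)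

𝟙-+-≤ : (P? : Dec P) (Q? : Dec Q) (R? : Dec R) →
  (P → R) → (Q → R) → (P → ¬ Q) → 𝟙 P? + 𝟙 Q? ≤ 𝟙 R?
𝟙-+-≤ (yes p) (yes q) _ _ _ disj = contradiction q (disj p)
𝟙-+-≤ (yes p) (no _) R? f _ _ = 𝟙-mono (yes p) R? f
𝟙-+-≤ (no _) Q? R? _ g _ = 𝟙-mono Q? R? g

𝟙-≤-+ : (P? : Dec P) (Q? : Dec Q) (R? : Dec R) → (R → P ⊎ Q) → 𝟙 R? ≤ 𝟙 P? + 𝟙 Q?
𝟙-≤-+ P? Q? (no _) _ = z≤n
𝟙-≤-+ P? Q? (yes r) f with f r
... | inj₁ p = ≤-trans (𝟙-mono (yes r) P? λ _ → p) (m≤m+n _ _)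
... | inj₂ q = ≤-trans (𝟙-mono (yes r) Q? λ _ → q) (m≤n+m _ _)

𝟙-⊎ : (P? : Dec P) (Q? : Dec Q) (R? : Dec R) →
  (R → P ⊎ Q) → (P → R) → (Q → R) → (P → ¬ Q) → 𝟙 R? ≡ 𝟙 P? + 𝟙 Q?
𝟙-⊎ P? Q? R? split f g disj = ≤-antisym (𝟙-≤-+ P? Q? R? split) (𝟙-+-≤ P? Q? R? f g disj)

𝟙-no : (P? : Dec P) → ¬ P → 𝟙 P? ≡ 0
𝟙-no (yes p) ¬p = contradiction p ¬p
𝟙-no (no _) _ = refl

∑-mono-≤ : ∀ {n} {f g : Fin n → ℕ} → (∀ i → f i ≤ g i) → sum f ≤ sum g
∑-mono-≤ {zero} _ = z≤n
∑-mono-≤ {suc n} f≤g = +-mono-≤ (f≤g zero) (∑-mono-≤ (f≤g ∘ suc))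

∑-zero : ∀ {n} (f : Fin n → ℕ) → (∀ i → f i ≡ 0) → sum f ≡ 0
∑-zero {n} f f≡0 = trans (sum-cong-≗ f≡0) (sum-replicate-zero n)

∑-single : ∀ {n} (f : Fin n → ℕ) (j : Fin n) → (∀ i → i ≢ j → f i ≡ 0) → sum f ≡ f j
∑-single f zero others =
  trans (cong (f zero +_) (∑-zero (f ∘ suc) λ i → others (suc i) λ ())) (+-identityʳ _)
∑-single f (suc j) others =
  trans (cong (_+ sum (f ∘ suc)) (others zero λ ()))
        (∑-single (f ∘ suc) j λ i i≢j → others (suc i) (i≢j ∘ suc-injective))

∑²-distrib-+ : ∀ {n} (f g : Fin n → Fin n → ℕ) →
  ∑[ u < n ] ∑[ w < n ] (f u w + g u w) ≡ ∑[ u < n ] ∑[ w < n ] f u w + ∑[ u < n ] ∑[ w < n ] g u w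
∑²-distrib-+ f g = trans (sum-cong-≗ λ u → ∑-distrib-+ (f u) (g u)) (∑-distrib-+ (sum ∘ f) (sum ∘ g))

listSum-allFin : ∀ {n} (f : Fin n → ℕ) → listSum (map f (allFin n)) ≡ sum f
listSum-allFin f = trans (cong listSum (map-tabulate id f)) (go f)
  where
  go : ∀ {n} (f : Fin n → ℕ) → listSum (tabulate f) ≡ sum f
  go {zero} f = refl
  go {suc n} f = cong (f zero +_) (go (f ∘ suc))

module _ {n : ℕ} where

  Ascending : Rel (Fin n) 0ℓ → Rel (Fin n) 0ℓ
  Ascending R u w = toℕ u < toℕ w × R u w

  ascending? : {R : Rel (Fin n) 0ℓ} → Decidable R → Decidable (Ascending R)
  ascending? R? u w = (toℕ u <? toℕ w) ×-dec R? u w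

  pairCount : {R : Rel (Fin n) 0ℓ} → Decidable R → ℕ
  pairCount R? = ∑[ u < n ] ∑[ w < n ] 𝟙 (ascending? R? u w)

  module _ {R S T : Rel (Fin n) 0ℓ} (R? : Decidable R) (S? : Decidable S) (T? : Decidable T) where

    pairCount-+-≤ : R ⇒ T → S ⇒ T → (∀ {u w} → R u w → ¬ S u w) →
      pairCount R? + pairCount S? ≤ pairCount T?
    pairCount-+-≤ R⇒T S⇒T disj = begin
      pairCount R? + pairCount S?
        ≡⟨ ∑²-distrib-+ (λ u w → 𝟙 (ascending? R? u w)) (λ u w → 𝟙 (ascending? S? u w)) ⟨
      ∑[ u < n ] ∑[ w < n ] (𝟙 (ascending? R? u w) + 𝟙 (ascending? S? u w))
        ≤⟨ ∑-mono-≤ (λ u → ∑-mono-≤ λ w → 𝟙-+-≤ (ascending? R? u w) (ascending? S? u w) (ascending? T? u w)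
             (λ (u<w , r) → u<w , R⇒T r) (λ (u<w , s) → u<w , S⇒T s) λ (_ , r) (_ , s) → disj r s) ⟩
      pairCount T? ∎
      where open ≤-Reasoning

    pairCount-≤-+ : T ⇒ (R ∪ S) → pairCount T? ≤ pairCount R? + pairCount S?
    pairCount-≤-+ T⇒R∪S = begin
      pairCount T?
        ≤⟨ ∑-mono-≤ (λ u → ∑-mono-≤ λ w → 𝟙-≤-+ (ascending? R? u w) (ascending? S? u w) (ascending? T? u w) split) ⟩
      ∑[ u < n ] ∑[ w < n ] (𝟙 (ascending? R? u w) + 𝟙 (ascending? S? u w))
        ≡⟨ ∑²-distrib-+ (λ u w → 𝟙 (ascending? R? u w)) (λ u w → 𝟙 (ascending? S? u w)) ⟩
      pairCount R? + pairCount S? ∎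
      where
      open ≤-Reasoning
      split : ∀ {u w} → Ascending T u w → Ascending R u w ⊎ Ascending S u w
      split (u<w , t) with T⇒R∪S t
      ... | inj₁ r = inj₁ (u<w , r)
      ... | inj₂ s = inj₂ (u<w , s)

  count : {D : Pred (Fin n) 0ℓ} → Decidable₁ D → ℕ
  count D? = ∑[ y < n ] 𝟙 (D? y)

  ∑²-row : ∀ z {P : Pred (Fin n) 0ℓ} (P? : Decidable₁ P) →
    ∑[ u < n ] ∑[ w < n ] 𝟙 ((u ≟ᶠ z) ×-dec P? w) ≡ count P?
  ∑²-row z P? =
    trans (∑-single _ z λ u u≢z → ∑-zero _ λ w → 𝟙-no ((u ≟ᶠ z) ×-dec P? w) (u≢z ∘ proj₁))
          (sum-cong-≗ λ w → 𝟙-cong ((z ≟ᶠ z) ×-dec P? w) (P? w) proj₂ (refl ,_))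

  ∑²-column : ∀ z {P : Pred (Fin n) 0ℓ} (P? : Decidable₁ P) →
    ∑[ u < n ] ∑[ w < n ] 𝟙 ((w ≟ᶠ z) ×-dec P? u) ≡ count P?
  ∑²-column z P? = sum-cong-≗ λ u →
    trans (∑-single _ z λ w w≢z → 𝟙-no ((w ≟ᶠ z) ×-dec P? u) (w≢z ∘ proj₁))
          (𝟙-cong ((z ≟ᶠ z) ×-dec P? u) (P? u) proj₂ (refl ,_))

  count-split : ∀ z {D : Pred (Fin n) 0ℓ} (D? : Decidable₁ D) → ¬ D z →
    count (λ y → (toℕ z <? toℕ y) ×-dec D? y) + count (λ y → (toℕ y <? toℕ z) ×-dec D? y) ≡ count D?
  count-split z {D} D? ¬Dz = begin
    count above + count below             ≡⟨ ∑-distrib-+ (𝟙 ∘ above) (𝟙 ∘ below) ⟨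
    ∑[ y < n ] (𝟙 (above y) + 𝟙 (below y)) ≡⟨ sum-cong-≗ (λ y → 𝟙-⊎ (above y) (below y) (D? y)
                                                (split y) proj₂ proj₂ λ (z<y , _) (y<z , _) → <-asym z<y y<z) ⟨
    count D? ∎
    where
    open ≡-Reasoning
    above below : Decidable₁ _
    above y = (toℕ z <? toℕ y) ×-dec D? y
    below y = (toℕ y <? toℕ z) ×-dec D? y
    split : ∀ y → D y → (toℕ z < toℕ y × D y) ⊎ (toℕ y < toℕ z × D y)
    split y d with <-cmp (toℕ z) (toℕ y)
    ... | tri< z<y _ _ = inj₁ (z<y , d)
    ... | tri≈ _ z≡y _ = contradiction (subst D (sym (toℕ-injective z≡y)) d) ¬Dz
    ... | tri> _ _ y<z = inj₂ (y<z , d)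

  Star : Fin n → Pred (Fin n) 0ℓ → Rel (Fin n) 0ℓ
  Star z D u w = (u ≡ z × D w) ⊎ (w ≡ z × D u)

  star? : ∀ z {D : Pred (Fin n) 0ℓ} → Decidable₁ D → Decidable (Star z D)
  star? z D? u w = ((u ≟ᶠ z) ×-dec D? w) ⊎-dec ((w ≟ᶠ z) ×-dec D? u)

  pairCount-star : ∀ z {D : Pred (Fin n) 0ℓ} (D? : Decidable₁ D) → ¬ D z →
    pairCount (star? z D?) ≡ count D?
  pairCount-star z {D} D? ¬Dz = begin
    pairCount (star? z D?)
      ≡⟨ sum-cong-≗ (λ u → sum-cong-≗ λ w → 𝟙-⊎ (z-first u w) (z-second u w) (ascending? (star? z D?) u w)
           split (λ { (refl , z<w , d) → z<w , inj₁ (refl , d) }) (λ { (refl , u<z , d) → u<z , inj₂ (refl , d) })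
           λ { (refl , z<z , _) (refl , _) → <-irrefl refl z<z }) ⟩
    ∑[ u < n ] ∑[ w < n ] (𝟙 (z-first u w) + 𝟙 (z-second u w))
      ≡⟨ ∑²-distrib-+ (λ u w → 𝟙 (z-first u w)) (λ u w → 𝟙 (z-second u w)) ⟩
    ∑[ u < n ] ∑[ w < n ] 𝟙 (z-first u w) + ∑[ u < n ] ∑[ w < n ] 𝟙 (z-second u w)
      ≡⟨ cong₂ _+_ (∑²-row z λ w → (toℕ z <? toℕ w) ×-dec D? w) (∑²-column z λ u → (toℕ u <? toℕ z) ×-dec D? u) ⟩
    count (λ y → (toℕ z <? toℕ y) ×-dec D? y) + count (λ y → (toℕ y <? toℕ z) ×-dec D? y)
      ≡⟨ count-split z D? ¬Dz ⟩
    count D? ∎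
    where
    open ≡-Reasoning
    z-first z-second : ∀ u w → Dec _
    z-first u w = (u ≟ᶠ z) ×-dec ((toℕ z <? toℕ w) ×-dec D? w)
    z-second u w = (w ≟ᶠ z) ×-dec ((toℕ u <? toℕ z) ×-dec D? u)
    split : ∀ {u w} → Ascending (Star z D) u w →
      (u ≡ z × toℕ z < toℕ w × D w) ⊎ (w ≡ z × toℕ u < toℕ z × D u)
    split (u<w , inj₁ (refl , d)) = inj₁ (refl , u<w , d)
    split (u<w , inj₂ (refl , d)) = inj₂ (refl , u<w , d)

module _ {n r k : ℕ} (c : Fin n → Fin r) (p : Fin n → Fin k) where

  SameBlockEdge : Rel (Fin n) 0ℓ
  SameBlockEdge u w = c u ≢ c w × p u ≡ p w

  sameBlockEdge? : Decidable SameBlockEdge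
  sameBlockEdge? u w = ¬? (c u ≟ᶠ c w) ×-dec (p u ≟ᶠ p w)

  inPartEdges≡pairCount : inPartEdges c p ≡ pairCount sameBlockEdge?
  inPartEdges≡pairCount =
    trans (listSum-allFin λ u → listSum (map (edge u) (allFin n))) (sum-cong-≗ λ u → listSum-allFin (edge u))
    where
    edge : Fin n → Fin n → ℕ
    edge u w = 𝟙 (ascending? sameBlockEdge? u w)

  NeighbourIn : Fin k → Fin n → Pred (Fin n) 0ℓ
  NeighbourIn j z y = p y ≡ j × c z ≢ c y

  neighbourIn? : ∀ j z → Decidable₁ (NeighbourIn j z)
  neighbourIn? j z y = (p y ≟ᶠ j) ×-dec ¬? (c z ≟ᶠ c y)

  degreeIn : Fin k → Fin n → ℕ
  degreeIn j z = count (neighbourIn? j z)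

  pairCount-star-neighbourIn : ∀ j z → pairCount (star? z (neighbourIn? j z)) ≡ degreeIn j z
  pairCount-star-neighbourIn j z = pairCount-star z (neighbourIn? j z) λ (_ , cz≢cz) → cz≢cz refl

  degreeIn-mono : ∀ {j v x} → (c v ≡ c x) ⊎ (∀ y → p y ≡ j → c x ≢ c y) → degreeIn j v ≤ degreeIn j x
  degreeIn-mono {j} {v} {x} h = ∑-mono-≤ λ y →
    𝟙-mono (neighbourIn? j v y) (neighbourIn? j x y) λ (py , cv≢cy) → py , neighbour-of-x h py cv≢cy
    where
    neighbour-of-x : ∀ {y} → (c v ≡ c x) ⊎ (∀ y → p y ≡ j → c x ≢ c y) → p y ≡ j → c v ≢ c y → c x ≢ c y
    neighbour-of-x {y} (inj₁ cv≡cx) _ cv≢cy = subst (λ col → col ≢ c y) cv≡cx cv≢cy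
    neighbour-of-x {y} (inj₂ j-avoids-cx) py _ = j-avoids-cx y py

module _ {s : ℕ} {i j : Fin (suc s)} (i≢j : i ≢ j) where

  merge : Fin (suc s) → Fin s
  merge k with k ≟ᶠ i
  ... | yes _ = punchOut i≢j
  ... | no k≢i = punchOut (k≢i ∘ sym)

  merge-identifies : merge i ≡ merge j
  merge-identifies with i ≟ᶠ i | j ≟ᶠ i
  ... | no i≢i | _ = contradiction refl i≢i
  ... | yes _ | yes j≡i = contradiction (sym j≡i) i≢j
  ... | yes _ | no _ = punchOut-cong i refl

  merge-punchIn : ∀ k → merge (punchIn i k) ≡ k
  merge-punchIn k with punchIn i k ≟ᶠ i
  ... | yes eq = contradiction eq (punchInᵢ≢i i k)
  ... | no _ = trans (punchOut-cong i refl) (punchOut-punchIn i)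

  module _ {n : ℕ} (p : Fin n → Fin (suc s)) where

    merge-isPartition : IsPartition p → IsPartition (merge ∘ p)
    merge-isPartition p-part k with p-part (punchIn i k)
    ... | y , py = y , trans (cong merge py) (merge-punchIn k)

    inPartEdges-merge : ∀ {r} (c : Fin n → Fin r) {x} → p x ≡ i →
      inPartEdges c p + degreeIn c p j x ≤ inPartEdges c (merge ∘ p)
    inPartEdges-merge c {x} px = begin
      inPartEdges c p + degreeIn c p j x
        ≡⟨ cong₂ _+_ (inPartEdges≡pairCount c p) (sym (pairCount-star-neighbourIn c p j x)) ⟩
      pairCount (sameBlockEdge? c p) + pairCount (star? x (neighbourIn? c p j x))
        ≤⟨ pairCount-+-≤ (sameBlockEdge? c p) (star? x (neighbourIn? c p j x)) (sameBlockEdge? c (merge ∘ p))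
             (λ (cu≢cw , pu≡pw) → cu≢cw , cong merge pu≡pw) star⇒edge disjoint ⟩
      pairCount (sameBlockEdge? c (merge ∘ p))
        ≡⟨ inPartEdges≡pairCount c (merge ∘ p) ⟨
      inPartEdges c (merge ∘ p) ∎
      where
      open ≤-Reasoning
      merge-x≡merge-j : ∀ {y} → p y ≡ j → merge (p x) ≡ merge (p y)
      merge-x≡merge-j py = trans (cong merge px) (trans merge-identifies (cong merge (sym py)))
      star⇒edge : Star x (NeighbourIn c p j x) ⇒ SameBlockEdge c (merge ∘ p)
      star⇒edge (inj₁ (refl , pw , cx≢cw)) = cx≢cw , merge-x≡merge-j pw
      star⇒edge (inj₂ (refl , pu , cx≢cu)) = cx≢cu ∘ sym , sym (merge-x≡merge-j pu)
      disjoint : ∀ {u w} → SameBlockEdge c p u w → ¬ Star x (NeighbourIn c p j x) u w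
      disjoint (_ , pu≡pw) (inj₁ (refl , pw , _)) = i≢j (trans (sym px) (trans pu≡pw pw))
      disjoint (_ , pu≡pw) (inj₂ (refl , pu , _)) = i≢j (trans (sym px) (trans (sym pu≡pw) pu))

module _ {n k : ℕ} (p : Fin n → Fin k) (v : Fin n) where

  isolate : Fin n → Fin (suc k)
  isolate y with y ≟ᶠ v
  ... | yes _ = zero
  ... | no _ = suc (p y)

  isolate-self : isolate v ≡ zero
  isolate-self with v ≟ᶠ v
  ... | yes _ = refl
  ... | no v≢v = contradiction refl v≢v

  isolate-≢ : ∀ {y} → y ≢ v → isolate y ≡ suc (p y)
  isolate-≢ {y} y≢v with y ≟ᶠ v
  ... | yes y≡v = contradiction y≡v y≢v
  ... | no _ = refl

  isolate-isPartition : IsPartition p → ∀ {o} → o ≢ v → p o ≡ p v → IsPartition isolate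
  isolate-isPartition p-part o≢v po≡pv zero = v , isolate-self
  isolate-isPartition p-part {o} o≢v po≡pv (suc t) with p-part t
  ... | y , py with y ≟ᶠ v
  ...   | no y≢v = y , trans (isolate-≢ y≢v) (cong suc py)
  ...   | yes refl = o , trans (isolate-≢ o≢v) (cong suc (trans po≡pv py))

  inPartEdges-isolate : ∀ {r} (c : Fin n → Fin r) {j} → p v ≡ j →
    inPartEdges c p ≤ inPartEdges c isolate + degreeIn c p j v
  inPartEdges-isolate c {j} pv = begin
    inPartEdges c p
      ≡⟨ inPartEdges≡pairCount c p ⟩
    pairCount (sameBlockEdge? c p)
      ≤⟨ pairCount-≤-+ (sameBlockEdge? c isolate) (star? v (neighbourIn? c p j v)) (sameBlockEdge? c p)
           edge-kept-or-cut ⟩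
    pairCount (sameBlockEdge? c isolate) + pairCount (star? v (neighbourIn? c p j v))
      ≡⟨ cong₂ _+_ (inPartEdges≡pairCount c isolate) (sym (pairCount-star-neighbourIn c p j v)) ⟨
    inPartEdges c isolate + degreeIn c p j v ∎
    where
    open ≤-Reasoning
    edge-kept-or-cut : SameBlockEdge c p ⇒ (SameBlockEdge c isolate ∪ Star v (NeighbourIn c p j v))
    edge-kept-or-cut {u} {w} = kept-or-cut (u ≟ᶠ v) (w ≟ᶠ v)
      where
      kept-or-cut : Dec (u ≡ v) → Dec (w ≡ v) → SameBlockEdge c p u w →
        SameBlockEdge c isolate u w ⊎ Star v (NeighbourIn c p j v) u w
      kept-or-cut (yes refl) _ (cu≢cw , pu≡pw) = inj₂ (inj₁ (refl , trans (sym pu≡pw) pv , cu≢cw))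
      kept-or-cut (no _) (yes refl) (cu≢cw , pu≡pw) = inj₂ (inj₂ (refl , trans pu≡pw pv , cu≢cw ∘ sym))
      kept-or-cut (no u≢v) (no w≢v) (cu≢cw , pu≡pw) =
        inj₁ (cu≢cw , trans (isolate-≢ u≢v) (trans (cong suc pu≡pw) (sym (isolate-≢ w≢v))))

midpoint-≤ : ∀ {e e₁ e₂ δ₁ δ₂} → e + δ₁ ≤ e₁ → e ≤ e₂ + δ₂ → δ₂ ≤ δ₁ → 2 * e ≤ e₁ + e₂
midpoint-≤ {e} {e₁} {e₂} {δ₁} {δ₂} gain loss δ₂≤δ₁ = +-cancelʳ-≤ δ₁ (2 * e) (e₁ + e₂) (begin
  2 * e + δ₁        ≡⟨ rearrange e δ₁ ⟩
  (e + δ₁) + e      ≤⟨ +-mono-≤ gain (≤-trans loss (+-monoʳ-≤ e₂ δ₂≤δ₁)) ⟩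
  e₁ + (e₂ + δ₁)    ≡⟨ +-assoc e₁ e₂ δ₁ ⟨
  e₁ + e₂ + δ₁      ∎)
  where
  open ≤-Reasoning
  rearrange : ∀ a b → 2 * a + b ≡ (a + b) + a
  rearrange = solve-∀

module _ {n r k : ℕ} (c : Fin n → Fin r) (p : Fin n → Fin k) where

  vertex-of-colour-or-all-neighbours : ∀ {j u} x → p u ≡ j →
    ∃ λ v → p v ≡ j × ((c v ≡ c x) ⊎ (∀ y → p y ≡ j → c x ≢ c y))
  vertex-of-colour-or-all-neighbours {j} {u} x pu with any? (λ y → (p y ≟ᶠ j) ×-dec (c y ≟ᶠ c x))
  ... | yes (y , py , cy≡cx) = y , py , inj₁ cy≡cx
  ... | no ∄ = u , pu , inj₂ λ y py cx≡cy → ∄ (y , py , sym cx≡cy)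

  another-in-block : ∀ {u₀ u₁} → u₀ ≢ u₁ → p u₀ ≡ p u₁ → ∀ {v} → p v ≡ p u₀ → ∃ λ o → o ≢ v × p o ≡ p v
  another-in-block {u₀} {u₁} u₀≢u₁ pu₀≡pu₁ {v} pv with v ≟ᶠ u₀
  ... | yes refl = u₁ , u₀≢u₁ ∘ sym , sym pu₀≡pu₁
  ... | no v≢u₀ = u₀ , v≢u₀ ∘ sym , sym pv

inPartEdges-midpoint : ∀ {n r k} (c : Fin n → Fin r) (p : Fin n → Fin (suc (suc k))) →
  IsPartition p → suc (suc k) < n →
  ∃₂ λ (q : Fin n → Fin (suc k)) (q′ : Fin n → Fin (suc (suc (suc k)))) →
    IsPartition q × IsPartition q′ × 2 * inPartEdges c p ≤ inPartEdges c q + inPartEdges c q′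
inPartEdges-midpoint c p p-part k<n =
  let (u₀ , u₁ , u₀<u₁ , pu₀≡pu₁) = pigeonhole k<n p
      j = p u₀
      i = punchIn j zero
      i≢j = punchInᵢ≢i j zero
      (x , px) = p-part i
      (v , pv , colour-choice) = vertex-of-colour-or-all-neighbours c p x refl
      (o , o≢v , po≡pv) = another-in-block c p (λ u₀≡u₁ → <-irrefl (cong toℕ u₀≡u₁) u₀<u₁) pu₀≡pu₁ pv
  in merge i≢j ∘ p , isolate p v , merge-isPartition i≢j p p-part , isolate-isPartition p v p-part o≢v po≡pv ,
     midpoint-≤ (inPartEdges-merge i≢j p c px) (inPartEdges-isolate p v c pv) (degreeIn-mono c p colour-choice)

maxInPartEdges-convex : ∀ {n r k a b d} (c : Fin n → Fin r) → suc (suc k) < n →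
  IsMaxInPartEdges c (suc k) a → IsMaxInPartEdges c (suc (suc k)) b → IsMaxInPartEdges c (suc (suc (suc k))) d →
  2 * b ≤ a + d
maxInPartEdges-convex c k<n (_ , a-max) ((p , p-part , refl) , _) (_ , d-max)
  with inPartEdges-midpoint c p p-part k<n
... | q , q′ , q-part , q′-part , midpoint =
  ≤-trans midpoint (+-mono-≤ (a-max q q-part) (d-max q′ q′-part))

lemma3 : (n r : ℕ) (c : Fin n → Fin r) → IsCompleteMultipartiteColouring c →
    (s : ℕ) → 2 ≤ s → s + 2 ≤ n →
    (a b d : ℕ) → IsMaxInPartEdges c s a → IsMaxInPartEdges c (s + 1) b →
    IsMaxInPartEdges c (s + 2) d →
    2 * b ≤ a + d
lemma3 n r c _ (suc s) (s≤s _) s+2≤n a b d A B D =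
  maxInPartEdges-convex c (subst (_≤ n) (+-comm (suc s) 2) s+2≤n) A
    (subst (λ t → IsMaxInPartEdges c t b) (+-comm (suc s) 1) B)
    (subst (λ t → IsMaxInPartEdges c t d) (+-comm (suc s) 2) D)
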